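{- Fix integers $s\ge 0$, $k>0$, $n>1$ and $\rho\ge 1$. Let $G$ be a biconnected graph with $n$ vertices $v_1,\ldots,v_n$, cyclomatic number $k$ and $s$ labeled external edges. Then for every $i\in\{1,\ldots,n\}$, the element ${q_i}^{(\rho)}_{\ge 1}(G)$ is a $\mathbb{Q}$-linear combination of biconnected graphs with $n+1$ vertices, cyclomatic number $k+\rho-1$ and $s$ labeled external edges. That is, ${q_i}^{(\rho)}_{\ge 1}$ maps $\mathbb{Q}W_{\mathrm{biconn}}^{n,k,s}$ into $\mathbb{Q}W_{\mathrm{biconn}}^{n+1,k+\rho-1,s}$.
   Context: Graphs: a graph has a finite nonempty vertex set, a finite set of internal edges, each joining two distinct vertices (multiple edges allowed, no loops), and a finite set of external edges, each attached to exactly one vertex at one end and free at the other end; the free ends of the $s$ external edges carry distinct labels $x_1,\ldots,x_s$. Each edge has two "ends"; the degree of a vertex is the number of edge ends assigned to it. A graph is connected if every pair of vertices is joined by a path of internal edges. The cyclomatic number of a graph is $m-n+c$, where $m$ is the number of internal edges, $n$ the number of vertices and $c$ the number of connected components. A graph is biconnected ($2$-connected) if it is connected and remains connected after deleting any vertex together with its attached edges. For a set $X$, $\mathbb{Q}X$ is the free $\mathbb{Q}$-vector space on $X$. $W_{\mathrm{conn}}^{n,k,s}$ (resp. $W_{\mathrm{biconn}}^{n,k,s}$) is the set of connected (resp. biconnected) such graphs with vertex set $\{v_1,\ldots,v_n\}$, cyclomatic number $k$ and $s$ external edges labeled $x_1,\ldots,x_s$. The map ${s_i}_{\ge 1}$: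 for a connected graph $G$ with vertices $v_1,\ldots,v_n$, let $\mathcal{E}_i$ be the set of ends of internal edges assigned to $v_i$ and $\mathcal{L}_i$ the set of external edges attached to $v_i$. If $|\mathcal{E}_i|<2$, set ${s_i}_{\ge 1}(G)=0$. Otherwise ${s_i}_{\ge 1}(G)$ is the sum, over all ordered partitions $(A,B)$ of $\mathcal{E}_i$ into two nonempty disjoint sets, and over all ways of assigning each external edge in $\mathcal{L}_i$ to one of two vertices $v_i,v_{n+1}$, of the graph obtained from $G$ by splitting $v_i$ into two vertices $v_i$ and a new vertex $v_{n+1}$, attaching the ends in $A$ to $v_i$, the ends in $B$ to $v_{n+1}$, and the external edges of $\mathcal{L}_i$ as prescribed by the assignment. The map $l_{i,n+1}$ adds one new internal edge joining $v_i$ and $v_{n+1}$; $l_{i,n+1}^{\rho}$ is its $\rho$-th iterate. Finally ${q_i}^{(\rho)}_{\ge 1}:=\frac{1}{2(\rho-1)!}\,l_{i,n+1}^{\rho}\circ {s_i}_{\ge 1}$, all maps extended linearly. -}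

module Defs where

import Data.Nat
open import Data.Nat using (ℕ; zero; suc; _+_; _*_; _∸_; _≤_; _<_; _≟_; NonZero)
open import Data.Nat.Properties using (_!≢0; m*n≢0)
open import Data.Nat.Combinatorics using ()
open import Data.Nat.Base using (_!)
open import Data.Fin using (Fin; inject₁; fromℕ)
import Data.Fin.Properties as FinP
open import Data.Vec using (Vec; []; _∷_)
import Data.Vec.Properties as VecP
open import Data.List using (List; []; _∷_; length; filter; map; concatMap; foldr)
open import Data.List.Relation.Unary.All using (All)
open import Data.List.Membership.Propositional using (_∈_)
open import Data.Product using (Σ; _×_; _,_; proj₁; proj₂)
open import Data.Sum using (_⊎_)
open import Data.Bool using (Bool; true; false; if_then_else_; _∧_)
open import Data.Integer using (+_)
open import Data.Rational using (ℚ; 0ℚ; 1ℚ; _/_) renaming (_+_ to _+ℚ_; _*_ to _*ℚ_)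
open import Relation.Nullary using (¬_; Dec; yes; no; does)
open import Relation.Nullary.Decidable using (_×-dec_; _⊎-dec_)
open import Relation.Binary.PropositionalEquality using (_≡_; _≢_)
open import Relation.Binary.Construct.Closure.ReflexiveTransitive using (Star)

-- Internal edges: a list of endpoint pairs (multiple edges allowed; each
-- edge has two ends: its first and its second component).
-- External edges: ext j = the vertex to which external edge x_(j+1) is attached.

record Graph (n s : ℕ) : Set where
  constructor graph
  field
    edges : List (Fin n × Fin n)
    ext   : Vec (Fin n) s
open Graph public

NoLoops : ∀ {n s} → Graph n s → Set
NoLoops G = All (λ e → proj₁ e ≢ proj₂ e) (edges G)

Adj : ∀ {n s} → Graph n s → Fin n → Fin n → Set
Adj G a b = ((a , b) ∈ edges G) ⊎ ((b , a) ∈ edges G)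

Connected : ∀ {n s} → Graph n s → Set
Connected {n} G = (a b : Fin n) → Star (Adj G) a b

AdjWithout : ∀ {n s} → Graph n s → Fin n → Fin n → Fin n → Set
AdjWithout G v a b = Adj G a b × a ≢ v × b ≢ v

ConnectedWithout : ∀ {n s} → Graph n s → Fin n → Set
ConnectedWithout {n} G v = (a b : Fin n) → a ≢ v → b ≢ v → Star (AdjWithout G v) a b

Biconnected : ∀ {n s} → Graph n s → Set
Biconnected {n} G = Connected G × ((v : Fin n) → ConnectedWithout G v)

-- Cyclomatic number m - n + c; for a connected graph c = 1, so
-- "cyclomatic number k" is m - n + 1 = k, i.e. m + 1 = n + k.
CyclomaticConn : ∀ {n s} → Graph n s → ℕ → Set
CyclomaticConn {n} G k = length (edges G) + 1 ≡ n + k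

InWBiconn : (n k s : ℕ) → Graph n s → Set
InWBiconn n k s G = NoLoops G × Biconnected G × CyclomaticConn G k

LinComb : ℕ → ℕ → Set
LinComb n s = List (ℚ × Graph n s)

mult : ∀ {n s} → Graph n s → Fin n → Fin n → ℕ
mult G a b = length (filter (λ e → ((proj₁ e FinP.≟ a) ×-dec (proj₂ e FinP.≟ b))
                                    ⊎-dec ((proj₁ e FinP.≟ b) ×-dec (proj₂ e FinP.≟ a)))
                            (edges G))

-- two graphs are the same element of W iff they have the same internal edge
-- multiset (unordered edges) and the same external edge attachments
_≈G?_ : ∀ {n s} (G H : Graph n s) →
        Dec (((a b : Fin n) → mult G a b ≡ mult H a b) × ext G ≡ ext H)
G ≈G? H = FinP.all? (λ a → FinP.all? (λ b → mult G a b ≟ mult H a b))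
          ×-dec VecP.≡-dec FinP._≟_ (ext G) (ext H)

coeff : ∀ {n s} → LinComb n s → Graph n s → ℚ
coeff [] H = 0ℚ
coeff ((q , G) ∷ c) H = (if does (G ≈G? H) then q else 0ℚ) +ℚ coeff c H

-- c lies in the subspace Q{G | P G} of Q W: it equals (in Q W) a
-- linear combination of graphs satisfying P
InSpan : ∀ {n s} → (Graph n s → Set) → LinComb n s → Set
InSpan {n} {s} P c = Σ (LinComb n s) λ d →
  All (λ t → P (proj₂ t)) d × ((H : Graph n s) → coeff c H ≡ coeff d H)

-- The splitting map s_i≥1.  The new vertex v_(n+1) is fromℕ n; old vertices
-- are embedded by inject₁.  For every end at v_i we choose to keep it at v_i
-- (end ∈ A) or move it to v_(n+1) (end ∈ B); we record (|A|, |B|).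

new : ∀ {n} → Fin (suc n)
new {n} = fromℕ n

endOpts : ∀ {n} → Fin n → Fin n → List (Fin (suc n) × ℕ × ℕ)
endOpts i a with a FinP.≟ i
... | yes _ = (inject₁ a , 1 , 0) ∷ (new , 0 , 1) ∷ []
... | no  _ = (inject₁ a , 0 , 0) ∷ []

edgeOpts : ∀ {n} → Fin n → Fin n × Fin n → List ((Fin (suc n) × Fin (suc n)) × ℕ × ℕ)
edgeOpts i (a , b) =
  concatMap (λ { (a' , x , y) →
    map (λ { (b' , x' , y') → ((a' , b') , x + x' , y + y') }) (endOpts i b) })
    (endOpts i a)

edgesOpts : ∀ {n} → Fin n → List (Fin n × Fin n) →
            List (List (Fin (suc n) × Fin (suc n)) × ℕ × ℕ)
edgesOpts i [] = ([] , 0 , 0) ∷ []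
edgesOpts i (e ∷ es) =
  concatMap (λ { (e' , x , y) →
    map (λ { (es' , x' , y') → (e' ∷ es' , x + x' , y + y') }) (edgesOpts i es) })
    (edgeOpts i e)

extOpts : ∀ {n s} → Fin n → Vec (Fin n) s → List (Vec (Fin (suc n)) s)
extOpts i [] = [] ∷ []
extOpts i (a ∷ as) with a FinP.≟ i
... | yes _ = concatMap (λ r → (inject₁ a ∷ r) ∷ (new ∷ r) ∷ []) (extOpts i as)
... | no  _ = map (inject₁ a ∷_) (extOpts i as)

endsAt : ∀ {n} → Fin n → List (Fin n × Fin n) → ℕ
endsAt i [] = 0
endsAt i ((a , b) ∷ es) =
  (if does (a FinP.≟ i) then 1 else 0) + (if does (b FinP.≟ i) then 1 else 0) + endsAt i es

splits : ∀ {n s} → Fin n → Graph n s → List (Graph (suc n) s)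
splits i G =
  if does (endsAt i (edges G) Data.Nat.<? 2) then [] else
  concatMap (λ { (es , x , y) →
      if does (1 Data.Nat.≤? x) ∧ does (1 Data.Nat.≤? y)
      then map (graph es) (extOpts i (ext G))
      else [] })
    (edgesOpts i (edges G))

addEdge : ∀ {n s} → Fin n → Graph (suc n) s → Graph (suc n) s
addEdge i (graph es xs) = graph ((inject₁ i , new) ∷ es) xs

iter : ∀ {A : Set} → ℕ → (A → A) → A → A
iter zero f x = x
iter (suc r) f x = f (iter r f x)

qcoeff : ℕ → ℚ
qcoeff ρ = _/_ (+ 1) (2 * (ρ ∸ 1) !) {{m*n≢0 2 ((ρ ∸ 1) !) {{_}} {{(ρ ∸ 1) !≢0}}}}

q≥1 : ∀ {n s} → Fin n → ℕ → Graph n s → LinComb (suc n) s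
q≥1 i ρ G = map (λ H → (qcoeff ρ , iter ρ (addEdge i) H)) (splits i G)

-- Splitting v_i into v_i and a new vertex v_(n+1), with both parts of the ends at v_i nonempty,
-- and joining the two by ρ ≥ 1 new edges keeps the graph biconnected. Every edge of G has an
-- image in the new graph, so paths of G lift (a path passing through v_i may need the new edge
-- to cross from one copy to the other); this handles connectivity and the deletion of any old
-- vertex other than v_i. Deleting one of the two copies of v_i leaves the image of G − v_i,
-- which is connected, together with the other copy; and that copy is attached to it because it
-- holds some end of an edge of G whose other end (no loops) is an old vertex different from v_i.
-- The split keeps the edge count, so the ρ new edges raise the cyclomatic number by ρ − 1.
module Submission where

open import Defs
open import Data.Nat using (ℕ; zero; suc; _+_; _∸_; _<_; _≤_; _≤?_; z≤n; s≤s)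
open import Data.Nat.Properties using (+-comm; +-assoc; +-suc)
open import Data.Fin using (Fin; inject₁)
import Data.Fin.Properties as FinP
open import Data.Fin.Relation.Unary.Top using (view; ‵fromℕ; ‵inj₁)
open import Data.List using (List; []; _∷_; [_]; length; map; concatMap; replicate; _++_)
open import Data.List.Properties using (length-++; length-replicate)
open import Data.List.Relation.Unary.All as All using (All; []; _∷_)
open import Data.List.Relation.Unary.All.Properties using (map⁺; concat⁺; ++⁺; replicate⁺)
open import Data.List.Relation.Unary.Any using (here; there)
open import Data.List.Relation.Binary.Pointwise using (Pointwise; []; _∷_)
open import Data.List.Relation.Binary.Pointwise.Properties using (Pointwise-length)
open import Data.List.Relation.Binary.Subset.Propositional using (_⊆_)
open import Data.List.Membership.Propositional using (_∈_)
open import Data.List.Membership.Propositional.Properties using (∈-++⁺ʳ)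
open import Data.Product using (Σ; ∃₂; _×_; _,_; proj₁; proj₂)
open import Data.Sum using (_⊎_; inj₁; inj₂)
open import Data.Bool using (Bool; true; false; if_then_else_; _∧_)
open import Data.Empty using (⊥-elim)
open import Relation.Nullary using (yes; no; does)
open import Relation.Binary.PropositionalEquality using (_≡_; _≢_; refl; sym; cong; cong₂; subst; subst₂; ≢-sym; module ≡-Reasoning)
open import Relation.Binary.Construct.Closure.ReflexiveTransitive using (Star; ε; _◅_; _◅◅_)

private
  variable
    n s : ℕ
    A B C : Set

1≤m+n⇒1≤m⊎1≤n : ∀ m n → 1 ≤ m + n → 1 ≤ m ⊎ 1 ≤ n
1≤m+n⇒1≤m⊎1≤n zero    n 1≤n = inj₂ 1≤n
1≤m+n⇒1≤m⊎1≤n (suc m) n _   = inj₁ (s≤s z≤n)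

concatMap⁺ : {P : B → Set} {f : A → List B} {xs : List A} →
             All (λ x → All P (f x)) xs → All P (concatMap f xs)
concatMap⁺ ps = concat⁺ (map⁺ ps)

concatMap-map⁺ : {P : A → Set} {Q : B → Set} {R : C → Set} {f : A → B → C}
                 {xs : List A} {ys : List B} →
                 (∀ {x y} → P x → Q y → R (f x y)) →
                 All P xs → All Q ys → All R (concatMap (λ x → map (f x) ys) xs)
concatMap-map⁺ pq⇒r ps qs = concatMap⁺ (All.map (λ p → map⁺ (All.map (pq⇒r p) qs)) ps)

if-[]-else⁺ : {P : A → Set} (b : Bool) {xs : List A} → All P xs →
              All P (if b then [] else xs)
if-[]-else⁺ true  _  = []
if-[]-else⁺ false ps = ps

Pointwise-∈ : {R : A → B → Set} {xs : List A} {ys : List B} {x : A} →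
              Pointwise R xs ys → x ∈ xs → Σ B λ y → R x y × y ∈ ys
Pointwise-∈ (r ∷ _)  (here refl) = _ , r , here refl
Pointwise-∈ (_ ∷ rs) (there x∈xs) with Pointwise-∈ rs x∈xs
... | y , r , y∈ys = y , r , there y∈ys

Pointwise-All : {R : A → B → Set} {P : A → Set} {Q : B → Set} →
                (∀ {x y} → R x y → P x → Q y) →
                ∀ {xs ys} → Pointwise R xs ys → All P xs → All Q ys
Pointwise-All r⇒ []       []       = []
Pointwise-All r⇒ (r ∷ rs) (p ∷ ps) = r⇒ r p ∷ Pointwise-All r⇒ rs ps

Star-lift : {R : A → A → Set} {S : B → B → Set} (L : A → B → Set) →
            (∀ {a b} → R a b → ∃₂ λ a' b' → L a a' × L b b' × S a' b') →
            (∀ {a a' a''} → L a a' → L a a'' → Star S a' a'') →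
            ∀ {a b a' b'} → Star R a b → L a a' → L b b' → Star S a' b'
Star-lift L lift join ε        la lb = join la lb
Star-lift L lift join (r ◅ rs) la lb with lift r
... | _ , _ , la₁ , lc , s = join la la₁ ◅◅ (s ◅ Star-lift L lift join rs lc lb)

data Image (i : Fin n) : Fin n → Fin (suc n) → Set where
  kept  : ∀ a → Image i a (inject₁ a)
  moved : Image i i new

Image-≢⇒inject₁ : {i a : Fin n} {a' : Fin (suc n)} → Image i a a' → a ≢ i → a' ≡ inject₁ a
Image-≢⇒inject₁ (kept a) _   = refl
Image-≢⇒inject₁ moved    a≢i = ⊥-elim (a≢i refl)

Image-preserves-≢ : {i a b : Fin n} {a' b' : Fin (suc n)} →
                Image i a a' → Image i b b' → a ≢ b → a' ≢ b'
Image-preserves-≢ (kept a) (kept b) a≢b eq = a≢b (FinP.inject₁-injective eq)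
Image-preserves-≢ (kept a) moved    _   eq = ≢-sym FinP.fromℕ≢inject₁ eq
Image-preserves-≢ moved    (kept b) _   eq = FinP.fromℕ≢inject₁ eq
Image-preserves-≢ moved    moved    a≢b _  = a≢b refl

EdgeImage : Fin n → Fin n × Fin n → Fin (suc n) × Fin (suc n) → Set
EdgeImage i (a , b) (a' , b') = Image i a a' × Image i b b'

AdjIn : ∀ {m} → List (Fin m × Fin m) → Fin m → Fin m → Set
AdjIn es x y = (x , y) ∈ es ⊎ (y , x) ∈ es

AdjIn-⊆ : ∀ {m} {es es' : List (Fin m × Fin m)} {x y} → es ⊆ es' → AdjIn es x y → AdjIn es' x y
AdjIn-⊆ sub (inj₁ xy) = inj₁ (sub xy)
AdjIn-⊆ sub (inj₂ yx) = inj₂ (sub yx)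

HasOldNeighbour : Fin n → Fin (suc n) → List (Fin (suc n) × Fin (suc n)) → Set
HasOldNeighbour {n} i p es = Σ (Fin n) λ u → u ≢ i × AdjIn es p (inject₁ u)

HasOldNeighbour-⊆ : {i : Fin n} {p : Fin (suc n)} {es es' : List (Fin (suc n) × Fin (suc n))} →
                    es ⊆ es' → HasOldNeighbour i p es → HasOldNeighbour i p es'
HasOldNeighbour-⊆ sub (u , u≢i , adj) = u , u≢i , AdjIn-⊆ sub adj

-- x counts the ends of v_i placed at the copy p of v_i; a positive count certifies that
-- the end a ↦ a' is one of them.
Certifies : Fin n → Fin (suc n) → ℕ → Fin n → Fin (suc n) → Set
Certifies i p x a a' = 1 ≤ x → a ≡ i × a' ≡ p

Witnesses : Fin n → Fin (suc n) → ℕ → List (Fin (suc n) × Fin (suc n)) → Set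
Witnesses i p x es = 1 ≤ x → HasOldNeighbour i p es

EndOption : Fin n → Fin n → Fin (suc n) × ℕ × ℕ → Set
EndOption i a (a' , x , y) = Image i a a' × Certifies i (inject₁ i) x a a' × Certifies i new y a a'

EdgeOption : Fin n → Fin n × Fin n → (Fin (suc n) × Fin (suc n)) × ℕ × ℕ → Set
EdgeOption i e (e' , x , y) =
  EdgeImage i e e' × Witnesses i (inject₁ i) x [ e' ] × Witnesses i new y [ e' ]

EdgesOption : Fin n → List (Fin n × Fin n) → List (Fin (suc n) × Fin (suc n)) × ℕ × ℕ → Set
EdgesOption i es (es' , x , y) =
  Pointwise (EdgeImage i) es es' × Witnesses i (inject₁ i) x es' × Witnesses i new y es'

endOpts⁺ : (i a : Fin n) → All (EndOption i a) (endOpts i a)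
endOpts⁺ i a with a FinP.≟ i
... | yes refl = (kept a , (λ _ → refl , refl) , λ ()) ∷ (moved , (λ ()) , λ _ → refl , refl) ∷ []
... | no _     = (kept a , (λ ()) , λ ()) ∷ []

edge-witnesses : {i a b : Fin n} {a' b' p : Fin (suc n)} {x x' : ℕ} → a ≢ b →
                 Image i a a' → Image i b b' → Certifies i p x a a' → Certifies i p x' b b' →
                 Witnesses i p (x + x') [ (a' , b') ]
edge-witnesses {x = x} {x'} a≢b ia ib ca cb 1≤x+x' with 1≤m+n⇒1≤m⊎1≤n x x' 1≤x+x'
... | inj₁ 1≤x with ca 1≤x
...   | refl , refl = _ , ≢-sym a≢b , inj₁ (here (cong (_ ,_) (sym (Image-≢⇒inject₁ ib (≢-sym a≢b)))))
edge-witnesses a≢b ia ib ca cb _ | inj₂ 1≤x' with cb 1≤x'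
...   | refl , refl = _ , a≢b , inj₂ (here (cong (_, _) (sym (Image-≢⇒inject₁ ia a≢b))))

Witnesses-∷ : ∀ {i : Fin n} {p x x' e' es'} →
              Witnesses i p x [ e' ] → Witnesses i p x' es' → Witnesses i p (x + x') (e' ∷ es')
Witnesses-∷ {x = x} {x'} w w' 1≤x+x' with 1≤m+n⇒1≤m⊎1≤n x x' 1≤x+x'
... | inj₁ 1≤x  = HasOldNeighbour-⊆ (λ { (here refl) → here refl }) (w 1≤x)
... | inj₂ 1≤x' = HasOldNeighbour-⊆ there (w' 1≤x')

edgeOpts⁺ : (i a b : Fin n) → a ≢ b → All (EdgeOption i (a , b)) (edgeOpts i (a , b))
edgeOpts⁺ i a b a≢b = concatMap-map⁺ combine (endOpts⁺ i a) (endOpts⁺ i b)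
  where
  combine : ∀ {t t'} → EndOption i a t → EndOption i b t' → EdgeOption i (a , b) _
  combine (ia , ca , ca') (ib , cb , cb') =
    (ia , ib) , edge-witnesses a≢b ia ib ca cb , edge-witnesses a≢b ia ib ca' cb'

edgesOpts⁺ : (i : Fin n) (es : List (Fin n × Fin n)) → All (λ e → proj₁ e ≢ proj₂ e) es →
             All (EdgesOption i es) (edgesOpts i es)
edgesOpts⁺ i []             []          = ([] , (λ ()) , λ ()) ∷ []
edgesOpts⁺ i ((a , b) ∷ es) (a≢b ∷ nls) =
  concatMap-map⁺ combine (edgeOpts⁺ i a b a≢b) (edgesOpts⁺ i es nls)
  where
  combine : ∀ {t t'} → EdgeOption i (a , b) t → EdgesOption i es t' → EdgesOption i ((a , b) ∷ es) _
  combine (im , w , w') (ims , ws , ws') = im ∷ ims , Witnesses-∷ w ws , Witnesses-∷ w' ws'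

IsSplit : Fin n → Graph n s → Graph (suc n) s → Set
IsSplit i G H = Pointwise (EdgeImage i) (edges G) (edges H) ×
                HasOldNeighbour i (inject₁ i) (edges H) × HasOldNeighbour i new (edges H)

splits⁺ : {G : Graph n s} (i : Fin n) → NoLoops G → All (IsSplit i G) (splits i G)
splits⁺ {G = G} i nl = if-[]-else⁺ _ (concatMap⁺ (All.map option⁺ (edgesOpts⁺ i (edges G) nl)))
  where
  option⁺ : ∀ {es' x y} → EdgesOption i (edges G) (es' , x , y) →
            All (IsSplit i G) (if does (1 ≤? x) ∧ does (1 ≤? y)
                               then map (graph es') (extOpts i (ext G)) else [])
  option⁺ {x = zero}            _                  = []
  option⁺ {x = suc _} {zero}    _                  = []
  option⁺ {x = suc _} {suc _}   (images , wA , wB) =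
    map⁺ (All.tabulate λ _ → images , wA (s≤s z≤n) , wB (s≤s z≤n))

data SplitView (i : Fin n) : Fin (suc n) → Set where
  new-vertex   : SplitView i new
  split-vertex : SplitView i (inject₁ i)
  other-vertex : ∀ x → x ≢ i → SplitView i (inject₁ x)

splitView : (i : Fin n) (x' : Fin (suc n)) → SplitView i x'
splitView i x' with view x'
... | ‵fromℕ   = new-vertex
... | ‵inj₁ {i = x} _ with x FinP.≟ i
...   | yes refl = split-vertex
...   | no x≢i   = other-vertex x x≢i

preimage : (i : Fin n) (x' : Fin (suc n)) → Σ (Fin n) λ a → Image i a x'
preimage i x' with splitView i x'
... | new-vertex       = i , moved
... | split-vertex     = i , kept i
... | other-vertex x _ = x , kept x

-- q is deleted and p is the other copy of v_i
data SplitPair (i : Fin n) : Fin (suc n) → Fin (suc n) → Set where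
  kept-new : SplitPair i (inject₁ i) new
  new-kept : SplitPair i new (inject₁ i)

data Remaining (i : Fin n) (p : Fin (suc n)) : Fin (suc n) → Set where
  partner : Remaining i p p
  other   : ∀ x → x ≢ i → Remaining i p (inject₁ x)

remaining : {i : Fin n} {p q : Fin (suc n)} → SplitPair i p q → (x' : Fin (suc n)) → x' ≢ q →
            Remaining i p x'
remaining {i = i} pair x' x'≢q with splitView i x' | pair
... | new-vertex       | kept-new = ⊥-elim (x'≢q refl)
... | new-vertex       | new-kept = partner
... | split-vertex     | kept-new = partner
... | split-vertex     | new-kept = ⊥-elim (x'≢q refl)
... | other-vertex x x≢i | _    = other x x≢i

partner≢deleted : {i : Fin n} {p q : Fin (suc n)} → SplitPair i p q → p ≢ q
partner≢deleted kept-new eq = ≢-sym FinP.fromℕ≢inject₁ eq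
partner≢deleted new-kept    = FinP.fromℕ≢inject₁

old≢deleted : {i x : Fin n} {p q : Fin (suc n)} → SplitPair i p q → x ≢ i → inject₁ x ≢ q
old≢deleted kept-new _   eq = ≢-sym FinP.fromℕ≢inject₁ eq
old≢deleted new-kept x≢i eq = x≢i (FinP.inject₁-injective eq)

module SplitBiconnected
  {G : Graph n s} {i : Fin n} (biconnected : Biconnected G)
  {es' : List (Fin (suc n) × Fin (suc n))} (images : Pointwise (EdgeImage i) (edges G) es')
  (kept-neighbour : HasOldNeighbour i (inject₁ i) es') (new-neighbour : HasOldNeighbour i new es')
  (K : Graph (suc n) s) (es'⊆K : es' ⊆ edges K) (bridge : Adj K (inject₁ i) new)
  where

  Adj-sym : ∀ {x y} → Adj K x y → Adj K y x
  Adj-sym (inj₁ xy) = inj₂ xy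
  Adj-sym (inj₂ yx) = inj₁ yx

  AdjWithout-sym : ∀ {q x y} → AdjWithout K q x y → AdjWithout K q y x
  AdjWithout-sym (adj , x≢q , y≢q) = Adj-sym adj , y≢q , x≢q

  lift-Adj : ∀ {a b} → Adj G a b → ∃₂ λ a' b' → Image i a a' × Image i b b' × Adj K a' b'
  lift-Adj (inj₁ ab∈G) with Pointwise-∈ images ab∈G
  ... | _ , (ia , ib) , e'∈es' = _ , _ , ia , ib , inj₁ (es'⊆K e'∈es')
  lift-Adj (inj₂ ba∈G) with Pointwise-∈ images ba∈G
  ... | _ , (ib , ia) , e'∈es' = _ , _ , ia , ib , inj₂ (es'⊆K e'∈es')

  connected : Connected K
  connected x y = Star-lift (Image i) lift-Adj join
    (proj₁ biconnected (proj₁ (preimage i x)) (proj₁ (preimage i y)))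
    (proj₂ (preimage i x)) (proj₂ (preimage i y))
    where
    join : ∀ {a a' a''} → Image i a a' → Image i a a'' → Star (Adj K) a' a''
    join (kept a) (kept a) = ε
    join (kept a) moved    = bridge ◅ ε
    join moved    (kept a) = Adj-sym bridge ◅ ε
    join moved    moved    = ε

  connected-without-other : (w : Fin n) → w ≢ i → ConnectedWithout K (inject₁ w)
  connected-without-other w w≢i x y x≢w y≢w =
    Star-lift Lift lift join (proj₂ biconnected w a b (avoids ia x≢w) (avoids ib y≢w))
      (ia , avoids ia x≢w) (ib , avoids ib y≢w)
    where
    Lift : Fin n → Fin (suc n) → Set
    Lift a a' = Image i a a' × a ≢ w
    a = proj₁ (preimage i x)
    b = proj₁ (preimage i y)
    ia = proj₂ (preimage i x)
    ib = proj₂ (preimage i y)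
    avoids : ∀ {a x} → Image i a x → x ≢ inject₁ w → a ≢ w
    avoids (kept a) x≢w a≡w = x≢w (cong inject₁ a≡w)
    avoids moved    _   i≡w = w≢i (sym i≡w)
    avoided : ∀ {a a'} → Image i a a' → a ≢ w → a' ≢ inject₁ w
    avoided ia a≢w = Image-preserves-≢ ia (kept w) a≢w
    lift : ∀ {a b} → AdjWithout G w a b →
           ∃₂ λ a' b' → Lift a a' × Lift b b' × AdjWithout K (inject₁ w) a' b'
    lift (adj , a≢w , b≢w) with lift-Adj adj
    ... | a' , b' , ia , ib , adj' =
      a' , b' , (ia , a≢w) , (ib , b≢w) , adj' , avoided ia a≢w , avoided ib b≢w
    i'≢w' : inject₁ i ≢ inject₁ w
    i'≢w' eq = w≢i (sym (FinP.inject₁-injective eq))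
    join : ∀ {a a' a''} → Lift a a' → Lift a a'' → Star (AdjWithout K (inject₁ w)) a' a''
    join (kept a , _) (kept a , _) = ε
    join (kept a , _) (moved  , _) = (bridge , i'≢w' , FinP.fromℕ≢inject₁) ◅ ε
    join (moved  , _) (kept a , _) = AdjWithout-sym (bridge , i'≢w' , FinP.fromℕ≢inject₁) ◅ ε
    join (moved  , _) (moved  , _) = ε

  old-path : ∀ {q} → (∀ {x} → x ≢ i → inject₁ x ≢ q) →
             ∀ {x y} → x ≢ i → y ≢ i → Star (AdjWithout K q) (inject₁ x) (inject₁ y)
  old-path {q} old≢q x≢i y≢i = Star-lift (λ a a' → a' ≡ inject₁ a) lift (λ { refl refl → ε })
    (proj₂ biconnected i _ _ x≢i y≢i) refl refl
    where
    lift : ∀ {a b} → AdjWithout G i a b →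
           ∃₂ λ a' b' → a' ≡ inject₁ a × b' ≡ inject₁ b × AdjWithout K q a' b'
    lift {a} {b} (adj , a≢i , b≢i) with lift-Adj adj
    ... | _ , _ , ia , ib , adj' = inject₁ a , inject₁ b , refl , refl ,
      subst₂ (Adj K) (Image-≢⇒inject₁ ia a≢i) (Image-≢⇒inject₁ ib b≢i) adj' , old≢q a≢i , old≢q b≢i

  partner-neighbour : ∀ {p q} → SplitPair i p q → HasOldNeighbour i p es'
  partner-neighbour kept-new = kept-neighbour
  partner-neighbour new-kept = new-neighbour

  attach : ∀ {p q} → SplitPair i p q → Σ (Fin n) λ u → u ≢ i × AdjWithout K q p (inject₁ u)
  attach pair with partner-neighbour pair
  ... | u , u≢i , adj = u , u≢i , AdjIn-⊆ es'⊆K adj , partner≢deleted pair , old≢deleted pair u≢i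

  connected-without-copy : ∀ {p q} → SplitPair i p q → ConnectedWithout K q
  connected-without-copy pair x y x≢q y≢q
    with remaining pair x x≢q | remaining pair y y≢q | attach pair
  ... | partner     | partner     | _                = ε
  ... | partner     | other y y≢i | u , u≢i , edge = edge ◅ old-path (old≢deleted pair) u≢i y≢i
  ... | other x x≢i | partner     | u , u≢i , edge =
    old-path (old≢deleted pair) x≢i u≢i ◅◅ (AdjWithout-sym edge ◅ ε)
  ... | other x x≢i | other y y≢i | _              = old-path (old≢deleted pair) x≢i y≢i

  biconnected′ : Biconnected K
  biconnected′ = connected , without
    where
    without : (w : Fin (suc n)) → ConnectedWithout K w
    without w with splitView i w
    ... | new-vertex         = connected-without-copy kept-new
    ... | split-vertex       = connected-without-copy new-kept
    ... | other-vertex w w≢i = connected-without-other w w≢i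

edges-iter-addEdge : (i : Fin n) (r : ℕ) (H : Graph (suc n) s) →
                     edges (iter r (addEdge i) H) ≡ replicate r (inject₁ i , new) ++ edges H
edges-iter-addEdge i zero    H = refl
edges-iter-addEdge i (suc r) H = cong ((inject₁ i , new) ∷_) (edges-iter-addEdge i r H)

cyclomatic-add : ∀ n k r m → m + 1 ≡ n + k → suc r + m + 1 ≡ suc n + (k + suc r ∸ 1)
cyclomatic-add n k r m m+1≡n+k rewrite +-suc k r = cong suc (begin
  r + m + 1   ≡⟨ +-assoc r m 1 ⟩
  r + (m + 1) ≡⟨ cong (r +_) m+1≡n+k ⟩
  r + (n + k) ≡⟨ +-comm r (n + k) ⟩
  n + k + r   ≡⟨ +-assoc n k r ⟩
  n + (k + r) ∎)
  where open ≡-Reasoning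

iter-addEdge-InWBiconn : {k : ℕ} {G : Graph n s} {H : Graph (suc n) s} {i : Fin n} (r : ℕ) →
                         InWBiconn n k s G → IsSplit i G H →
                         InWBiconn (suc n) (k + suc r ∸ 1) s (iter (suc r) (addEdge i) H)
iter-addEdge-InWBiconn {n = n} {k = k} {G} {H} {i} r (noLoops , biconnected , cyclomatic)
                       (images , kept-neighbour , new-neighbour) =
  subst (All (λ e → proj₁ e ≢ proj₂ e)) (sym edges-K) loop-free ,
  SplitBiconnected.biconnected′ {G = G} {i = i} biconnected images kept-neighbour new-neighbour K
    (λ e∈H → there (subst (_ ∈_) (sym (edges-iter-addEdge i r H)) (∈-++⁺ʳ _ e∈H)))
    (inj₁ (here refl)) ,
  (begin
    length (edges K) + 1                       ≡⟨ cong (λ es → length es + 1) edges-K ⟩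
    length (replicate (suc r) link ++ edges H) + 1 ≡⟨ cong (_+ 1) length-edges ⟩
    suc r + length (edges G) + 1               ≡⟨ cyclomatic-add n k r _ cyclomatic ⟩
    suc n + (k + suc r ∸ 1)                    ∎)
  where
  open ≡-Reasoning
  link = (inject₁ i , new)
  K = iter (suc r) (addEdge i) H
  edges-K = edges-iter-addEdge i (suc r) H
  loop-free : All (λ e → proj₁ e ≢ proj₂ e) (replicate (suc r) link ++ edges H)
  loop-free = ++⁺ (replicate⁺ (suc r) (≢-sym FinP.fromℕ≢inject₁))
                  (Pointwise-All (λ { (ia , ib) → Image-preserves-≢ ia ib }) images noLoops)
  length-edges : length (replicate (suc r) link ++ edges H) ≡ suc r + length (edges G)
  length-edges = begin
    length (replicate (suc r) link ++ edges H)         ≡⟨ length-++ (replicate (suc r) link) ⟩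
    length (replicate (suc r) link) + length (edges H) ≡⟨ cong₂ _+_ (length-replicate (suc r))
                                                           (sym (Pointwise-length images)) ⟩
    suc r + length (edges G)                           ∎

lemma1 : (s k n ρ : ℕ) → 0 < k → 1 < n → 1 ≤ ρ →
         (G : Graph n s) → InWBiconn n k s G →
         (i : Fin n) → InSpan (InWBiconn (suc n) (k + ρ ∸ 1) s) (q≥1 i ρ G)
lemma1 s k n (suc r) _ _ _ G W@(noLoops , _) i =
  q≥1 i (suc r) G ,
  map⁺ (All.map (iter-addEdge-InWBiconn {G = G} r W) (splits⁺ {G = G} i noLoops)) ,
  λ _ → refl
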